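{- Let $\mathcal{G}=((V,E),\lambda)$ be a 1D-mobility temporal clique on $n\ge 2$ nodes. Then there are exactly two orderings of $V$, namely some ordering $\pi$ and its reversal, from which $\mathcal{R}(\mathcal{G})$ is a 1D-mobility schedule.
   Context: A temporal clique $\mathcal{G}=((V,E),\lambda)$ is a complete graph on $n$ nodes with each edge given a single label, labels pairwise distinct; its representation $\mathcal{R}(\mathcal{G})$ is the list of triples $(u,v,\lambda(uv))$ sorted by label. 1D-mobility model: agents lie on a line in an initial ordering $\pi$. A 1D-mobility schedule from $\pi$ is a sequence $x=(x_1,\dots,x_T)$ of pairs where, with $\pi_0=\pi$, each $x_t=\{u,v\}$ consists of two agents consecutive in $\pi_{t-1}$ and $\pi_t$ is obtained by exchanging them. $\mathcal{G}_{\pi,x}$ is the temporal graph with edge $uv$ at time $t$ whenever $x_t=uv$. A 1D-mobility temporal clique is a temporal clique isomorphic (label-preserving vertex bijection) to some $\mathcal{G}_{\pi,x}$. "$\mathcal{R}(\mathcal{G})$ is a 1D-mobility schedule from $\pi$" means the edges of $\mathcal{R}(\mathcal{G})$, read in increasing label order as crossings, form a valid 1D-mobility schedule from $\pi$. -}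

module Defs where

open import Data.Nat using (ℕ; zero; suc; _<_)
open import Data.Fin using (Fin)
open import Data.List using (List; []; _∷_; allFin)
open import Data.List.Relation.Unary.Linked using (Linked)
open import Data.List.Membership.Propositional using (_∈_)
open import Data.List.Relation.Binary.Permutation.Propositional using (_↭_)
open import Data.Fin.Permutation using (Permutation′; _⟨$⟩ʳ_)
open import Data.Product using (_×_; _,_; Σ; ∃; proj₁; proj₂)
open import Data.Sum using (_⊎_)
open import Relation.Binary.PropositionalEquality using (_≡_; _≢_)
open import Function.Bundles using (_⇔_)

-- Vertices / agents are Fin n.  A labelling assigns a natural-number label
-- to every (unordered) edge; λ u u is irrelevant.
Labelling : ℕ → Set
Labelling n = Fin n → Fin n → ℕ

record IsTemporalClique {n : ℕ} (lab : Labelling n) : Set where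
  field
    symmetric : ∀ u v → lab u v ≡ lab v u
    distinct  : ∀ u v u′ v′ → u ≢ v → u′ ≢ v′ → lab u v ≡ lab u′ v′ →
                (u ≡ u′ × v ≡ v′) ⊎ (u ≡ v′ × v ≡ u′)

IsOrdering : {n : ℕ} → List (Fin n) → Set
IsOrdering {n} π = π ↭ allFin n

data Swap {A : Set} : List A → A → A → List A → Set where
  here  : ∀ {a b ys} → Swap (a ∷ b ∷ ys) a b (b ∷ a ∷ ys)
  there : ∀ {c xs a b ys} → Swap xs a b ys → Swap (c ∷ xs) a b (c ∷ ys)

SwapPair : {A : Set} → List A → A → A → List A → Set
SwapPair π u v π′ = Swap π u v π′ ⊎ Swap π v u π′

data IsSchedule {A : Set} : List A → List (A × A) → Set where
  done : ∀ {π} → IsSchedule π []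
  step : ∀ {π π′ u v xs} → SwapPair π u v π′ → IsSchedule π′ xs →
         IsSchedule π ((u , v) ∷ xs)

-- EdgeAt x t u v : x_t = {u,v}  (times start at 1).
data EdgeAt {A : Set} : List (A × A) → ℕ → A → A → Set where
  hd  : ∀ {u v xs} → EdgeAt ((u , v) ∷ xs) 1 u v
  hd′ : ∀ {u v xs} → EdgeAt ((u , v) ∷ xs) 1 v u
  tl  : ∀ {p xs t u v} → EdgeAt xs t u v → EdgeAt (p ∷ xs) (suc t) u v

-- G is isomorphic (label-preserving bijection f : agents → V) to G_{π,x}:
-- for distinct agents u, v, the edge uv is present at time t in G_{π,x}
-- iff λ(f u, f v) = t.
IsomorphicToMobility : {n : ℕ} → Labelling n → List (Fin n) →
                       List (Fin n × Fin n) → Set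
IsomorphicToMobility {n} lab π x =
  Σ (Permutation′ n) λ f →
    ∀ (u v : Fin n) → u ≢ v → ∀ (t : ℕ) →
      EdgeAt x t u v ⇔ (lab (f ⟨$⟩ʳ u) (f ⟨$⟩ʳ v) ≡ t)

IsMobilityClique : {n : ℕ} → Labelling n → Set
IsMobilityClique {n} lab =
  IsTemporalClique lab ×
  ∃ λ (π : List (Fin n)) → ∃ λ (x : List (Fin n × Fin n)) →
    IsOrdering π × IsSchedule π x × IsomorphicToMobility lab π x

-- rs is the representation R(G): the list of edges (u,v) (u ≠ v), each edge
-- of the clique occurring, sorted by strictly increasing label.  (The label
-- component of each triple is λ(u,v) and is left implicit.)
IsRepresentation : {n : ℕ} → Labelling n → List (Fin n × Fin n) → Set
IsRepresentation {n} lab rs =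
  (∀ {u v} → (u , v) ∈ rs → u ≢ v) ×
  (∀ (u v : Fin n) → u ≢ v → ((u , v) ∈ rs) ⊎ ((v , u) ∈ rs)) ×
  Linked (λ p q → lab (proj₁ p) (proj₂ p) < lab (proj₁ q) (proj₂ q)) rs

{-# OPTIONS --safe #-}
-- The schedule exists because transporting the mobility schedule along the
-- isomorphism gives a schedule whose t-th crossing carries label t, hence is
-- R(G) up to the orientation of each pair; on the reversed line every crossing
-- is still a crossing of neighbours.
--
-- For uniqueness, compare two initial orderings σ, τ from which R(G) is a
-- schedule through D(a,b) = [σ and τ order a, b differently].  Crossing the
-- same neighbours u, v in both lines leaves D unchanged, and just before that
-- crossing D(w,u) = D(w,v) for every other w, since w lies on the same side of
-- two neighbours.  As every pair crosses, D is constant on distinct pairs, so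
-- τ orders every pair as σ does, or every pair oppositely.  σ cannot be
-- opposite to both π and its reversal, which differ when n ≥ 2.

module Submission where

open import Defs
open import Data.Bool using (Bool; true; false; not; _xor_)
open import Data.Bool.Properties using (not-injective; not-involutive)
open import Data.Fin using (Fin; zero; suc; _≟_)
open import Data.Fin.Permutation using (Permutation′; _⟨$⟩ʳ_; _⟨$⟩ˡ_; inverseʳ)
open import Data.List using (List; []; _∷_; _++_; [_]; map; reverse)
open import Data.List.Properties using (∷-injectiveˡ; ∷-injectiveʳ; reverse-++)
open import Data.List.Membership.Propositional using (_∈_)
open import Data.List.Relation.Binary.Subset.Propositional using (_⊆_)
open import Data.List.Membership.Propositional.Properties using (∈-map⁺; ∈-map⁻; ∈-allFin)
open import Data.List.Membership.Propositional.Properties.WithK using (unique∧set⇒bag)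
open import Data.List.Relation.Binary.BagAndSetEquality using (∼bag⇒↭)
open import Data.List.Relation.Binary.Equality.Propositional using (≋⇒≡)
open import Data.List.Relation.Binary.Permutation.Propositional
  using (_↭_; ↭-sym; ↭-trans; ↭-refl; prep; swap; ↭⇒↭ₛ)
open import Data.List.Relation.Binary.Permutation.Propositional.Properties using (∈-resp-↭; ↭-reverse)
open import Data.List.Relation.Binary.Permutation.Setoid.Properties using (Unique-resp-↭)
open import Data.List.Relation.Unary.All as All using (All; []; _∷_)
open import Data.List.Relation.Unary.AllPairs as AllPairs using (_∷_)
open import Data.List.Relation.Unary.Any using (here; there)
open import Data.List.Relation.Unary.Any.Properties using (reverse⁻)
open import Data.List.Relation.Unary.Linked as Linked using (Linked; []; [-]; _∷_)
open import Data.List.Relation.Unary.Linked.Properties as Linkedₚ using (Linked⇒AllPairs)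
open import Data.List.Relation.Unary.Sorted.TotalOrder.Properties using (↗↭↗⇒≋)
open import Data.List.Relation.Unary.Unique.Propositional using (Unique)
open import Data.List.Relation.Unary.Unique.Propositional.Properties as Unique using (allFin⁺)
open import Data.Nat using (ℕ; zero; suc; _+_; _<_; _≥_; _<ᵇ_; s≤s)
open import Data.Nat.Properties
  using (suc-injective; 1+n≢n; <-trans; <⇒≢; <⇒≤; ≤-totalOrder; +-suc; +-monoʳ-<; n<1+n)
open import Data.Product as Product using (_×_; _,_; ∃; proj₁; proj₂)
open import Data.Sum as Sum using (_⊎_; inj₁; inj₂)
open import Function using (_∘_; _on_; _⇔_; mk⇔; Equivalence)
open import Function.Bundles using (Injection)
open import Function.Properties.Inverse using (↔⇒↣)
open import Relation.Nullary using (yes; no; contradiction)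
open import Relation.Binary.PropositionalEquality
  using (_≡_; _≢_; ≢-sym; refl; sym; trans; cong; cong₂; subst; subst₂; setoid; module ≡-Reasoning)

private
  variable
    A B : Set
    n : ℕ
    a b c d x : A
    xs ys : List A
    u v w : Fin n
    σ σ′ τ τ′ : List (Fin n)

unique∧set⇒↭ : Unique xs → Unique ys → (∀ {x} → x ∈ xs ⇔ x ∈ ys) → xs ↭ ys
unique∧set⇒↭ xs! ys! xs≈ys = ∼bag⇒↭ (unique∧set⇒bag xs! ys! xs≈ys)

∈-∷-≢ : x ∈ c ∷ xs → c ≢ x → x ∈ xs
∈-∷-≢ (here refl) c≢x = contradiction refl c≢x
∈-∷-≢ (there x∈xs) _ = x∈xs

head-∉ : Unique (c ∷ xs) → x ∈ xs → c ≢ x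
head-∉ (c∉xs ∷ _) = All.lookup c∉xs

strictlySorted-set⇒≡ : {ks ls : List ℕ} → Linked _<_ ks → Linked _<_ ls →
                       (∀ {k} → k ∈ ks ⇔ k ∈ ls) → ks ≡ ls
strictlySorted-set⇒≡ ks↗ ls↗ ks≈ls =
  ≋⇒≡ (↗↭↗⇒≋ ≤-totalOrder (Linked.map <⇒≤ ks↗) (Linked.map <⇒≤ ls↗)
         (↭⇒↭ₛ (unique∧set⇒↭ (unique ks↗) (unique ls↗) ks≈ls)))
  where
  unique : {ks : List ℕ} → Linked _<_ ks → Unique ks
  unique ks↗ = AllPairs.map <⇒≢ (Linked⇒AllPairs <-trans ks↗)

IsOrdering⇒Unique : IsOrdering σ → Unique σ
IsOrdering⇒Unique {n} σ↭ = Unique-resp-↭ (setoid (Fin n)) (↭⇒↭ₛ (↭-sym σ↭)) (allFin⁺ n)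

IsOrdering⇒∈ : IsOrdering σ → ∀ x → x ∈ σ
IsOrdering⇒∈ σ↭ x = ∈-resp-↭ (↭-sym σ↭) (∈-allFin x)

unique∧complete⇒IsOrdering : Unique σ → (∀ x → x ∈ σ) → IsOrdering σ
unique∧complete⇒IsOrdering {n} σ! σ-complete =
  unique∧set⇒↭ σ! (allFin⁺ n) (λ {x} → mk⇔ (λ _ → ∈-allFin x) (λ _ → σ-complete x))

map-IsOrdering : (f : Permutation′ n) → IsOrdering σ → IsOrdering (map (f ⟨$⟩ʳ_) σ)
map-IsOrdering f σ-ord = unique∧complete⇒IsOrdering
  (Unique.map⁺ (Injection.injective (↔⇒↣ f)) (IsOrdering⇒Unique σ-ord))
  (λ x → subst (_∈ _) (inverseʳ f) (∈-map⁺ (f ⟨$⟩ʳ_) (IsOrdering⇒∈ σ-ord (f ⟨$⟩ˡ x))))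

IsOrdering-reverse : IsOrdering σ → IsOrdering (reverse σ)
IsOrdering-reverse {σ = σ} σ-ord = ↭-trans (↭-reverse σ) σ-ord

unique⇒≢reverse : Unique (c ∷ d ∷ xs) → c ∷ d ∷ xs ≢ reverse (c ∷ d ∷ xs)
unique⇒≢reverse {c = c} {d} {xs} c∷d∷xs! palindrome
  with reverse (d ∷ xs) in rev | trans palindrome (reverse-++ [ c ] (d ∷ xs))
... | z ∷ _ | c∷d∷xs≡z∷_ =
  head-∉ c∷d∷xs! (reverse⁻ (subst (z ∈_) (sym rev) (here refl))) (∷-injectiveˡ c∷d∷xs≡z∷_)

IsOrdering⇒≢reverse : {σ : List (Fin (suc (suc n)))} → IsOrdering σ → σ ≢ reverse σ
IsOrdering⇒≢reverse {σ = []} σ-ord with () ← IsOrdering⇒∈ σ-ord zero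
IsOrdering⇒≢reverse {σ = _ ∷ []} σ-ord with IsOrdering⇒∈ σ-ord zero | IsOrdering⇒∈ σ-ord (suc zero)
... | here refl | here ()
IsOrdering⇒≢reverse {σ = _ ∷ _ ∷ _} σ-ord = unique⇒≢reverse (IsOrdering⇒Unique σ-ord)

Swap⇒∈ : Swap xs a b ys → a ∈ xs × b ∈ xs
Swap⇒∈ here      = here refl , there (here refl)
Swap⇒∈ (there s) = Product.map there there (Swap⇒∈ s)

Swap⇒↭ : Swap xs a b ys → xs ↭ ys
Swap⇒↭ here      = swap _ _ ↭-refl
Swap⇒↭ (there s) = prep _ (Swap⇒↭ s)

SwapPair-IsOrdering : IsOrdering σ → SwapPair σ u v σ′ → IsOrdering σ′
SwapPair-IsOrdering σ-ord s = ↭-trans (↭-sym (Sum.[ Swap⇒↭ , Swap⇒↭ ] s)) σ-ord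

Swap-map : (g : A → B) → Swap xs a b ys → Swap (map g xs) (g a) (g b) (map g ys)
Swap-map g here      = here
Swap-map g (there s) = there (Swap-map g s)

IsSchedule-map : (g : A → B) {σ : List A} {ps : List (A × A)} →
                 IsSchedule σ ps → IsSchedule (map g σ) (map (Product.map g g) ps)
IsSchedule-map g done         = done
IsSchedule-map g (step s run) = step (Sum.map (Swap-map g) (Swap-map g) s) (IsSchedule-map g run)

Swap-++ˡ : (zs : List A) → Swap xs a b ys → Swap (zs ++ xs) a b (zs ++ ys)
Swap-++ˡ []       s = s
Swap-++ˡ (z ∷ zs) s = there (Swap-++ˡ zs s)

Swap-++ʳ : (zs : List A) → Swap xs a b ys → Swap (xs ++ zs) a b (ys ++ zs)
Swap-++ʳ zs here      = here
Swap-++ʳ zs (there s) = there (Swap-++ʳ zs s)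

Swap-reverse : Swap xs a b ys → Swap (reverse xs) b a (reverse ys)
Swap-reverse {a = a} {b} (here {ys = ys}) =
  subst₂ (λ p q → Swap p b a q)
         (sym (reverse-++ (a ∷ b ∷ []) ys)) (sym (reverse-++ (b ∷ a ∷ []) ys))
         (Swap-++ˡ (reverse ys) here)
Swap-reverse {a = a} {b} (there {c = c} {xs} {ys = ys} s) =
  subst₂ (λ p q → Swap p b a q) (sym (reverse-++ [ c ] xs)) (sym (reverse-++ [ c ] ys))
         (Swap-++ʳ [ c ] (Swap-reverse s))

IsSchedule-reverse : {σ : List A} {ps : List (A × A)} → IsSchedule σ ps → IsSchedule (reverse σ) ps
IsSchedule-reverse done         = done
IsSchedule-reverse (step s run) =
  step (Sum.swap (Sum.map Swap-reverse Swap-reverse s)) (IsSchedule-reverse run)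

-- Positions in a line, and how a crossing of neighbours moves them
pos : List (Fin n) → Fin n → ℕ
pos []      x = 0
pos (c ∷ σ) x with c ≟ x
... | yes _ = 0
... | no  _ = suc (pos σ x)

pos-here : (x : Fin n) (σ : List (Fin n)) → pos (x ∷ σ) x ≡ 0
pos-here x σ with x ≟ x
... | yes _  = refl
... | no x≢x = contradiction refl x≢x

pos-there : {c x : Fin n} (σ : List (Fin n)) → c ≢ x → pos (c ∷ σ) x ≡ suc (pos σ x)
pos-there {c = c} {x} σ c≢x with c ≟ x
... | yes c≡x = contradiction c≡x c≢x
... | no  _   = refl

pos-injective : {x y : Fin n} (σ : List (Fin n)) → x ∈ σ → y ∈ σ → pos σ x ≡ pos σ y → x ≡ y
pos-injective {x = x} {y} (c ∷ σ) x∈ y∈ eq with c ≟ x | c ≟ y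
... | yes c≡x | yes c≡y = trans (sym c≡x) c≡y
... | yes _   | no  _   = contradiction eq λ ()
... | no  _   | yes _   = contradiction eq λ ()
... | no  c≢x | no  c≢y = pos-injective σ (∈-∷-≢ x∈ c≢x) (∈-∷-≢ y∈ c≢y) (suc-injective eq)

record Crossing (σ σ′ : List (Fin n)) (u v : Fin n) : Set where
  field
    adjacent : pos σ v ≡ suc (pos σ u) ⊎ pos σ u ≡ suc (pos σ v)
    moved-u  : pos σ′ u ≡ pos σ v
    moved-v  : pos σ′ v ≡ pos σ u
    unmoved  : ∀ x → x ≢ u → x ≢ v → pos σ′ x ≡ pos σ x

Crossing-sym : Crossing σ σ′ u v → Crossing σ σ′ v u
Crossing-sym X = record
  { adjacent = Sum.swap adjacent
  ; moved-u  = moved-v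
  ; moved-v  = moved-u
  ; unmoved  = λ x x≢v x≢u → unmoved x x≢u x≢v
  }
  where open Crossing X

Crossing-∷ : {c : Fin n} → c ≢ u → c ≢ v → Crossing σ σ′ u v → Crossing (c ∷ σ) (c ∷ σ′) u v
Crossing-∷ {u = u} {v = v} {σ = σ} {σ′ = σ′} {c = c} c≢u c≢v X = record
  { adjacent = Sum.map (successor c≢v c≢u) (successor c≢u c≢v) adjacent
  ; moved-u  = same c≢u c≢v moved-u
  ; moved-v  = same c≢v c≢u moved-v
  ; unmoved  = unmoved′
  }
  where
  open Crossing X
  successor : ∀ {x y} → c ≢ x → c ≢ y →
              pos σ x ≡ suc (pos σ y) → pos (c ∷ σ) x ≡ suc (pos (c ∷ σ) y)
  successor c≢x c≢y eq = trans (pos-there σ c≢x) (cong suc (trans eq (sym (pos-there σ c≢y))))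
  same : ∀ {x y} → c ≢ x → c ≢ y → pos σ′ x ≡ pos σ y → pos (c ∷ σ′) x ≡ pos (c ∷ σ) y
  same c≢x c≢y eq = trans (pos-there σ′ c≢x) (trans (cong suc eq) (sym (pos-there σ c≢y)))
  unmoved′ : ∀ x → x ≢ u → x ≢ v → pos (c ∷ σ′) x ≡ pos (c ∷ σ) x
  unmoved′ x x≢u x≢v with c ≟ x
  ... | yes _ = refl
  ... | no  _ = cong suc (unmoved x x≢u x≢v)

Swap⇒Crossing : Unique σ → Swap σ u v σ′ → Crossing σ σ′ u v
Swap⇒Crossing {σ = u ∷ v ∷ ys} {u = u} {v = v} ((u≢v ∷ _) ∷ _) here = record
  { adjacent = inj₁ (trans (second u≢v) (cong suc (sym (pos-here u (v ∷ ys)))))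
  ; moved-u  = trans (second (≢-sym u≢v)) (sym (second u≢v))
  ; moved-v  = trans (pos-here v (u ∷ ys)) (sym (pos-here u (v ∷ ys)))
  ; unmoved  = λ x x≢u x≢v →
      trans (beyond (≢-sym x≢v) (≢-sym x≢u)) (sym (beyond (≢-sym x≢u) (≢-sym x≢v)))
  }
  where
  second : ∀ {a b} → a ≢ b → pos (a ∷ b ∷ ys) b ≡ 1
  second {b = b} a≢b = trans (pos-there (b ∷ ys) a≢b) (cong suc (pos-here b ys))
  beyond : ∀ {a b x} → a ≢ x → b ≢ x → pos (a ∷ b ∷ ys) x ≡ suc (suc (pos ys x))
  beyond {b = b} a≢x b≢x = trans (pos-there (b ∷ ys) a≢x) (cong suc (pos-there ys b≢x))
Swap⇒Crossing σ!@(_ ∷ xs!) (there s) =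
  Crossing-∷ (head-∉ σ! (proj₁ (Swap⇒∈ s))) (head-∉ σ! (proj₂ (Swap⇒∈ s))) (Swap⇒Crossing xs! s)

SwapPair⇒Crossing : Unique σ → SwapPair σ u v σ′ → Crossing σ σ′ u v
SwapPair⇒Crossing σ! (inj₁ s) = Swap⇒Crossing σ! s
SwapPair⇒Crossing σ! (inj₂ s) = Crossing-sym (Swap⇒Crossing σ! s)

Crossing⇒≢ : Crossing σ σ′ u v → u ≢ v
Crossing⇒≢ X refl with Crossing.adjacent X
... | inj₁ eq = 1+n≢n (sym eq)
... | inj₂ eq = 1+n≢n (sym eq)

Distinct : A × A → Set
Distinct (u , v) = u ≢ v

IsSchedule⇒Distinct : {ps : List (Fin n × Fin n)} →
                      IsOrdering σ → IsSchedule σ ps → All Distinct ps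
IsSchedule⇒Distinct σ-ord done         = []
IsSchedule⇒Distinct σ-ord (step s run) =
  Crossing⇒≢ (SwapPair⇒Crossing (IsOrdering⇒Unique σ-ord) s) ∷
  IsSchedule⇒Distinct (SwapPair-IsOrdering σ-ord s) run

-- Precedence
precedes : List (Fin n) → Fin n → Fin n → Bool
precedes σ a b = pos σ a <ᵇ pos σ b

SamePrecedence : List (Fin n) → List (Fin n) → Set
SamePrecedence σ τ = ∀ {a b} → a ≢ b → precedes σ a b ≡ precedes τ a b

OppositePrecedence : List (Fin n) → List (Fin n) → Set
OppositePrecedence σ τ = ∀ {a b} → a ≢ b → precedes σ a b ≡ not (precedes τ a b)

<ᵇ-flip : ∀ i j → i ≢ j → (j <ᵇ i) ≡ not (i <ᵇ j)
<ᵇ-flip zero    zero    i≢j = contradiction refl i≢j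
<ᵇ-flip zero    (suc j) _   = refl
<ᵇ-flip (suc i) zero    _   = refl
<ᵇ-flip (suc i) (suc j) i≢j = <ᵇ-flip i j (i≢j ∘ cong suc)

<ᵇ-skip : ∀ k i → k ≢ i → (k <ᵇ i) ≡ (k <ᵇ suc i)
<ᵇ-skip zero    zero    k≢i = contradiction refl k≢i
<ᵇ-skip zero    (suc i) _   = refl
<ᵇ-skip (suc k) zero    _   = refl
<ᵇ-skip (suc k) (suc i) k≢i = <ᵇ-skip k i (k≢i ∘ cong suc)

precedes-∷ : {c a b : Fin n} (σ : List (Fin n)) → c ≢ a → c ≢ b → precedes (c ∷ σ) a b ≡ precedes σ a b
precedes-∷ σ c≢a c≢b = cong₂ _<ᵇ_ (pos-there σ c≢a) (pos-there σ c≢b)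

head-precedes : {c x : Fin n} (σ : List (Fin n)) → c ≢ x → precedes (c ∷ σ) c x ≡ true
head-precedes {c = c} σ c≢x = cong₂ _<ᵇ_ (pos-here c σ) (pos-there σ c≢x)

nothing-precedes-head : {c x : Fin n} (σ : List (Fin n)) → precedes (c ∷ σ) x c ≡ false
nothing-precedes-head {c = c} {x} σ = cong (pos (c ∷ σ) x <ᵇ_) (pos-here c σ)

precedes-extensional : Unique σ → Unique τ → σ ⊆ τ → τ ⊆ σ →
  (∀ {a b} → a ∈ σ → b ∈ σ → a ≢ b → precedes σ a b ≡ precedes τ a b) → σ ≡ τ
precedes-extensional {σ = []}    {[]}    _ _ _ _ _ = refl
precedes-extensional {σ = []}    {_ ∷ _} _ _ _ τ⊆σ _ with () ← τ⊆σ (here refl)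
precedes-extensional {σ = _ ∷ _} {[]}    _ _ σ⊆τ _ _ with () ← σ⊆τ (here refl)
precedes-extensional {σ = a ∷ σ} {b ∷ τ} a∷σ!@(_ ∷ σ!) b∷τ!@(_ ∷ τ!) σ⊆τ τ⊆σ agree with b ≟ a
... | no b≢a = contradiction
  (trans (sym (nothing-precedes-head {c = a} {b} σ))
         (trans (agree (τ⊆σ (here refl)) (here refl) b≢a) (head-precedes τ b≢a)))
  λ ()
... | yes refl = cong (a ∷_) (precedes-extensional σ! τ! σ⊆τ′ τ⊆σ′ agree′)
  where
  σ⊆τ′ : σ ⊆ τ
  σ⊆τ′ x∈σ = ∈-∷-≢ (σ⊆τ (there x∈σ)) (head-∉ a∷σ! x∈σ)
  τ⊆σ′ : τ ⊆ σ
  τ⊆σ′ x∈τ = ∈-∷-≢ (τ⊆σ (there x∈τ)) (head-∉ b∷τ! x∈τ)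
  agree′ : ∀ {x y} → x ∈ σ → y ∈ σ → x ≢ y → precedes σ x y ≡ precedes τ x y
  agree′ {x} {y} x∈σ y∈σ x≢y = begin
    precedes σ x y        ≡⟨ precedes-∷ σ a≢x a≢y ⟨
    precedes (a ∷ σ) x y  ≡⟨ agree (there x∈σ) (there y∈σ) x≢y ⟩
    precedes (a ∷ τ) x y  ≡⟨ precedes-∷ τ a≢x a≢y ⟩
    precedes τ x y        ∎
    where
    open ≡-Reasoning
    a≢x : a ≢ x
    a≢x = head-∉ a∷σ! x∈σ
    a≢y : a ≢ y
    a≢y = head-∉ a∷σ! y∈σ

precedes-injective : IsOrdering σ → IsOrdering τ → SamePrecedence σ τ → σ ≡ τ
precedes-injective σ-ord τ-ord agree = precedes-extensional
  (IsOrdering⇒Unique σ-ord) (IsOrdering⇒Unique τ-ord)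
  (λ {x} _ → IsOrdering⇒∈ τ-ord x) (λ {x} _ → IsOrdering⇒∈ σ-ord x) (λ _ _ → agree)

module _ {σ : List (Fin n)} (σ-ord : IsOrdering σ) where

  pos-≢ : a ≢ b → pos σ a ≢ pos σ b
  pos-≢ a≢b = a≢b ∘ pos-injective σ (IsOrdering⇒∈ σ-ord _) (IsOrdering⇒∈ σ-ord _)

  precedes-flip : a ≢ b → precedes σ b a ≡ not (precedes σ a b)
  precedes-flip a≢b = <ᵇ-flip _ _ (pos-≢ a≢b)

  module _ {σ′ : List (Fin n)} {u v : Fin n} (X : Crossing σ σ′ u v) where
    open Crossing X

    precedes-adjacentʳ : w ≢ u → w ≢ v → precedes σ w u ≡ precedes σ w v
    precedes-adjacentʳ {w} w≢u w≢v with adjacent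
    ... | inj₁ v-next = trans (<ᵇ-skip _ _ (pos-≢ w≢u)) (cong (pos σ w <ᵇ_) (sym v-next))
    ... | inj₂ u-next = sym (trans (<ᵇ-skip _ _ (pos-≢ w≢v)) (cong (pos σ w <ᵇ_) (sym u-next)))

    precedes-adjacentˡ : w ≢ u → w ≢ v → precedes σ u w ≡ precedes σ v w
    precedes-adjacentˡ {w} w≢u w≢v = begin
      precedes σ u w        ≡⟨ precedes-flip w≢u ⟩
      not (precedes σ w u)  ≡⟨ cong not (precedes-adjacentʳ w≢u w≢v) ⟩
      not (precedes σ w v)  ≡⟨ precedes-flip w≢v ⟨
      precedes σ v w        ∎
      where open ≡-Reasoning

    precedes-crossed : precedes σ′ u v ≡ precedes σ v u
    precedes-crossed = cong₂ _<ᵇ_ moved-u moved-v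

    precedes-endpointˡ : w ≢ u → w ≢ v → precedes σ′ u w ≡ precedes σ u w
    precedes-endpointˡ {w} w≢u w≢v =
      trans (cong₂ _<ᵇ_ moved-u (unmoved w w≢u w≢v)) (sym (precedes-adjacentˡ w≢u w≢v))

    precedes-endpointʳ : w ≢ u → w ≢ v → precedes σ′ w u ≡ precedes σ w u
    precedes-endpointʳ {w} w≢u w≢v =
      trans (cong₂ _<ᵇ_ (unmoved w w≢u w≢v) moved-u) (sym (precedes-adjacentʳ w≢u w≢v))

-- Disagreement between two lines running the same schedule
disagreement : List (Fin n) → List (Fin n) → Fin n → Fin n → Bool
disagreement σ τ a b = precedes σ a b xor precedes τ a b

not-xor-not : ∀ p q → (not p xor not q) ≡ (p xor q)
not-xor-not true  q = refl
not-xor-not false q = not-involutive q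

endpoint? : (u v x : Fin n) → x ≡ u ⊎ x ≡ v ⊎ (x ≢ u × x ≢ v)
endpoint? u v x with x ≟ u | x ≟ v
... | yes x≡u | _       = inj₁ x≡u
... | no  _   | yes x≡v = inj₂ (inj₁ x≡v)
... | no  x≢u | no  x≢v = inj₂ (inj₂ (x≢u , x≢v))

module _ {σ τ : List (Fin n)} (σ-ord : IsOrdering σ) (τ-ord : IsOrdering τ) where

  disagreement-sym : a ≢ b → disagreement σ τ b a ≡ disagreement σ τ a b
  disagreement-sym {a} {b} a≢b =
    trans (cong₂ _xor_ (precedes-flip σ-ord a≢b) (precedes-flip τ-ord a≢b))
          (not-xor-not (precedes σ a b) (precedes τ a b))

  module _ {σ′ τ′ : List (Fin n)} {u v : Fin n}
           (X : Crossing σ σ′ u v) (Y : Crossing τ τ′ u v) where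

    disagreement-adjacent : w ≢ u → w ≢ v → disagreement σ τ w u ≡ disagreement σ τ w v
    disagreement-adjacent w≢u w≢v =
      cong₂ _xor_ (precedes-adjacentʳ σ-ord X w≢u w≢v) (precedes-adjacentʳ τ-ord Y w≢u w≢v)

    disagreement-crossed : disagreement σ′ τ′ u v ≡ disagreement σ τ u v
    disagreement-crossed = trans (cong₂ _xor_ (precedes-crossed σ-ord X) (precedes-crossed τ-ord Y))
                                 (disagreement-sym (Crossing⇒≢ X))

    disagreement-endpointˡ : w ≢ u → w ≢ v → disagreement σ′ τ′ u w ≡ disagreement σ τ u w
    disagreement-endpointˡ w≢u w≢v =
      cong₂ _xor_ (precedes-endpointˡ σ-ord X w≢u w≢v) (precedes-endpointˡ τ-ord Y w≢u w≢v)

    disagreement-endpointʳ : w ≢ u → w ≢ v → disagreement σ′ τ′ w u ≡ disagreement σ τ w u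
    disagreement-endpointʳ w≢u w≢v =
      cong₂ _xor_ (precedes-endpointʳ σ-ord X w≢u w≢v) (precedes-endpointʳ τ-ord Y w≢u w≢v)

    disagreement-unmoved : a ≢ u → a ≢ v → b ≢ u → b ≢ v →
                           disagreement σ′ τ′ a b ≡ disagreement σ τ a b
    disagreement-unmoved {a} {b} a≢u a≢v b≢u b≢v =
      cong₂ _xor_ (cong₂ _<ᵇ_ (unmoved X a a≢u a≢v) (unmoved X b b≢u b≢v))
                  (cong₂ _<ᵇ_ (unmoved Y a a≢u a≢v) (unmoved Y b b≢u b≢v))
      where open Crossing

  disagreement-crossing : Crossing σ σ′ u v → Crossing τ τ′ u v →
                          a ≢ b → disagreement σ′ τ′ a b ≡ disagreement σ τ a b
  disagreement-crossing {u = u} {v = v} {a = a} {b = b} X Y a≢b with endpoint? u v a | endpoint? u v b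
  ... | inj₁ refl | inj₁ refl = contradiction refl a≢b
  ... | inj₁ refl | inj₂ (inj₁ refl) = disagreement-crossed X Y
  ... | inj₁ refl | inj₂ (inj₂ (b≢u , b≢v)) = disagreement-endpointˡ X Y b≢u b≢v
  ... | inj₂ (inj₁ refl) | inj₁ refl = disagreement-crossed (Crossing-sym X) (Crossing-sym Y)
  ... | inj₂ (inj₁ refl) | inj₂ (inj₁ refl) = contradiction refl a≢b
  ... | inj₂ (inj₁ refl) | inj₂ (inj₂ (b≢u , b≢v)) =
    disagreement-endpointˡ (Crossing-sym X) (Crossing-sym Y) b≢v b≢u
  ... | inj₂ (inj₂ (a≢u , a≢v)) | inj₁ refl = disagreement-endpointʳ X Y a≢u a≢v
  ... | inj₂ (inj₂ (a≢u , a≢v)) | inj₂ (inj₁ refl) =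
    disagreement-endpointʳ (Crossing-sym X) (Crossing-sym Y) a≢v a≢u
  ... | inj₂ (inj₂ (a≢u , a≢v)) | inj₂ (inj₂ (b≢u , b≢v)) =
    disagreement-unmoved X Y a≢u a≢v b≢u b≢v

disagreement-scheduled : {ps : List (Fin n × Fin n)} →
  IsOrdering σ → IsOrdering τ → IsSchedule σ ps → IsSchedule τ ps →
  (u , v) ∈ ps → w ≢ u → w ≢ v → disagreement σ τ w u ≡ disagreement σ τ w v
disagreement-scheduled σ-ord τ-ord (step s _) (step t _) (here refl) w≢u w≢v =
  disagreement-adjacent σ-ord τ-ord (SwapPair⇒Crossing (IsOrdering⇒Unique σ-ord) s)
                                    (SwapPair⇒Crossing (IsOrdering⇒Unique τ-ord) t) w≢u w≢v
disagreement-scheduled {σ = σ} {τ = τ} {u = u} {v = v} {w = w} σ-ord τ-ord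
                       (step {π′ = σ′} s σ′-run) (step {π′ = τ′} t τ′-run) (there uv∈) w≢u w≢v = begin
  disagreement σ τ w u    ≡⟨ crossing w≢u ⟨
  disagreement σ′ τ′ w u  ≡⟨ disagreement-scheduled σ′-ord τ′-ord σ′-run τ′-run uv∈ w≢u w≢v ⟩
  disagreement σ′ τ′ w v  ≡⟨ crossing w≢v ⟩
  disagreement σ τ w v    ∎
  where
  open ≡-Reasoning
  σ′-ord : IsOrdering σ′
  σ′-ord = SwapPair-IsOrdering σ-ord s
  τ′-ord : IsOrdering τ′
  τ′-ord = SwapPair-IsOrdering τ-ord t
  crossing : ∀ {a b} → a ≢ b → disagreement σ′ τ′ a b ≡ disagreement σ τ a b
  crossing = disagreement-crossing σ-ord τ-ord (SwapPair⇒Crossing (IsOrdering⇒Unique σ-ord) s)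
                                               (SwapPair⇒Crossing (IsOrdering⇒Unique τ-ord) t)

module _ {B : Set} (E : Fin n → Fin n → B)
         (E-sym : ∀ {a b} → a ≢ b → E b a ≡ E a b)
         (E-ignores-second : ∀ {w a b} → w ≢ a → w ≢ b → a ≢ b → E w a ≡ E w b) where

  constant-in-second : a ≢ b → a ≢ d → E a b ≡ E a d
  constant-in-second {b = b} {d = d} a≢b a≢d with b ≟ d
  ... | yes refl = refl
  ... | no  b≢d  = E-ignores-second a≢b a≢d b≢d

  constant-on-distinct : a ≢ b → c ≢ d → E a b ≡ E c d
  constant-on-distinct {a = a} {b = b} {c = c} {d = d} a≢b c≢d with c ≟ a
  ... | yes refl = constant-in-second a≢b c≢d
  ... | no  c≢a  = begin
    E a b  ≡⟨ constant-in-second a≢b (≢-sym c≢a) ⟩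
    E a c  ≡⟨ E-sym (≢-sym c≢a) ⟨
    E c a  ≡⟨ constant-in-second c≢a c≢d ⟩
    E c d  ∎
    where open ≡-Reasoning

CoversAllPairs : List (A × A) → Set
CoversAllPairs {A} ps = ∀ (a b : A) → a ≢ b → (a , b) ∈ ps ⊎ (b , a) ∈ ps

xor≡false⇒≡ : ∀ {p q} → p xor q ≡ false → p ≡ q
xor≡false⇒≡ {true}  {true}  _ = refl
xor≡false⇒≡ {false} {false} _ = refl

xor≡true⇒≡not : ∀ {p q} → p xor q ≡ true → p ≡ not q
xor≡true⇒≡not {true}  {false} _ = refl
xor≡true⇒≡not {false} {true}  _ = refl

module _ {σ τ : List (Fin (suc (suc n)))} {ps : List (Fin (suc (suc n)) × Fin (suc (suc n)))}
         (ps-covers : CoversAllPairs ps)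
         (σ-ord : IsOrdering σ) (σ-run : IsSchedule σ ps)
         (τ-ord : IsOrdering τ) (τ-run : IsSchedule τ ps) where

  disagreement-constant : a ≢ b → c ≢ d → disagreement σ τ a b ≡ disagreement σ τ c d
  disagreement-constant = constant-on-distinct (disagreement σ τ) (disagreement-sym σ-ord τ-ord) second
    where
    second : w ≢ a → w ≢ b → a ≢ b → disagreement σ τ w a ≡ disagreement σ τ w b
    second {a = a} {b = b} w≢a w≢b a≢b with ps-covers a b a≢b
    ... | inj₁ ab∈ = disagreement-scheduled σ-ord τ-ord σ-run τ-run ab∈ w≢a w≢b
    ... | inj₂ ba∈ = sym (disagreement-scheduled σ-ord τ-ord σ-run τ-run ba∈ w≢b w≢a)

  precedes-same-or-opposite : SamePrecedence σ τ ⊎ OppositePrecedence σ τ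
  precedes-same-or-opposite with disagreement σ τ zero (suc zero) in d₀
  ... | false = inj₁ λ a≢b → xor≡false⇒≡ (trans (disagreement-constant a≢b λ ()) d₀)
  ... | true  = inj₂ λ a≢b → xor≡true⇒≡not (trans (disagreement-constant a≢b λ ()) d₀)

schedule-origin-unique : {π σ : List (Fin (suc (suc n)))}
                         {ps : List (Fin (suc (suc n)) × Fin (suc (suc n)))} →
  CoversAllPairs ps → IsOrdering π → IsSchedule π ps → IsOrdering σ → IsSchedule σ ps →
  σ ≡ π ⊎ σ ≡ reverse π
schedule-origin-unique {π = π} {σ} ps-covers π-ord π-run σ-ord σ-run =
  decide (precedes-same-or-opposite ps-covers σ-ord σ-run π-ord π-run)
         (precedes-same-or-opposite ps-covers σ-ord σ-run πʳ-ord (IsSchedule-reverse π-run))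
  where
  πʳ-ord : IsOrdering (reverse π)
  πʳ-ord = IsOrdering-reverse π-ord
  decide : SamePrecedence σ π ⊎ OppositePrecedence σ π →
           SamePrecedence σ (reverse π) ⊎ OppositePrecedence σ (reverse π) → σ ≡ π ⊎ σ ≡ reverse π
  decide (inj₁ same) _           = inj₁ (precedes-injective σ-ord π-ord same)
  decide (inj₂ _)    (inj₁ same) = inj₂ (precedes-injective σ-ord πʳ-ord same)
  decide (inj₂ opp)  (inj₂ opp′) = contradiction
    (precedes-injective π-ord πʳ-ord λ a≢b → not-injective (trans (sym (opp a≢b)) (opp′ a≢b)))
    (IsOrdering⇒≢reverse π-ord)

-- Labels along a schedule
EdgeAt⇒∈ : {ps : List (A × A)} {t : ℕ} → EdgeAt ps t a b → (a , b) ∈ ps ⊎ (b , a) ∈ ps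
EdgeAt⇒∈ hd      = inj₁ (here refl)
EdgeAt⇒∈ hd′     = inj₂ (here refl)
EdgeAt⇒∈ (tl e) = Sum.map there there (EdgeAt⇒∈ e)

consecutive⇒Linked : (κ : A × A → ℕ) (s : ℕ) {xs : List (A × A)} → All Distinct xs →
  (∀ {t u v} → u ≢ v → EdgeAt xs t u v → κ (u , v) ≡ s + t) → Linked (_<_ on κ) xs
consecutive⇒Linked κ s []           _      = []
consecutive⇒Linked κ s (_ ∷ [])     _      = [-]
consecutive⇒Linked κ s (d ∷ d′ ∷ ds) κ≡s+t =
  subst₂ _<_ (sym (κ≡s+t d hd)) (sym (κ≡s+t d′ (tl hd))) (+-monoʳ-< s (n<1+n 1)) ∷
  consecutive⇒Linked κ (suc s) (d′ ∷ ds) (λ u≢v e → trans (κ≡s+t u≢v (tl e)) (+-suc s _))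

label : Labelling n → Fin n × Fin n → ℕ
label lab p = lab (proj₁ p) (proj₂ p)

labels : Labelling n → List (Fin n × Fin n) → List ℕ
labels lab = map (label lab)

module _ {lab : Labelling n} (clique : IsTemporalClique lab) where
  open IsTemporalClique clique

  label-∈ : {ps : List (Fin n × Fin n)} → (u , v) ∈ ps ⊎ (v , u) ∈ ps → lab u v ∈ labels lab ps
  label-∈ (inj₁ uv∈) = ∈-map⁺ (label lab) uv∈
  label-∈ {u = u} {v = v} {ps = ps} (inj₂ vu∈) =
    subst (_∈ labels lab ps) (symmetric v u) (∈-map⁺ (label lab) vu∈)

  labels-⊆-covering : {ps qs : List (Fin n × Fin n)} → All Distinct ps → CoversAllPairs qs →
                      labels lab ps ⊆ labels lab qs
  labels-⊆-covering ps-distinct qs-covers k∈ with ∈-map⁻ (label lab) k∈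
  ... | (u , v) , uv∈ , refl = label-∈ (qs-covers u v (All.lookup ps-distinct uv∈))

  IsSchedule-sameLabels : {ps qs : List (Fin n × Fin n)} → IsSchedule σ ps →
    labels lab ps ≡ labels lab qs → All Distinct ps → All Distinct qs → IsSchedule σ qs
  IsSchedule-sameLabels done _ [] [] = done
  IsSchedule-sameLabels (step {u = a} {v = b} s run) same (a≢b ∷ ps-distinct) (c≢d ∷ qs-distinct)
    with distinct a b _ _ a≢b c≢d (∷-injectiveˡ same)
       | IsSchedule-sameLabels run (∷-injectiveʳ same) ps-distinct qs-distinct
  ... | inj₁ (refl , refl) | rest = step s rest
  ... | inj₂ (refl , refl) | rest = step (Sum.swap s) rest

  module _ {π : List (Fin n)} {x : List (Fin n × Fin n)}
           (π-ord : IsOrdering π) (x-run : IsSchedule π x) (mobility : IsomorphicToMobility lab π x) where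

    private
      f : Permutation′ n
      f = proj₁ mobility
      F : Fin n → Fin n
      F = f ⟨$⟩ʳ_
      x′ : List (Fin n × Fin n)
      x′ = map (Product.map F F) x
      x′-run : IsSchedule (map F π) x′
      x′-run = IsSchedule-map F x-run
      x′-distinct : All Distinct x′
      x′-distinct = IsSchedule⇒Distinct (map-IsOrdering f π-ord) x′-run

      x′-sorted : Linked _<_ (labels lab x′)
      x′-sorted = Linkedₚ.map⁺ (Linkedₚ.map⁺
        (consecutive⇒Linked (label lab ∘ Product.map F F) 0 (IsSchedule⇒Distinct π-ord x-run)
                            λ u≢v e → Equivalence.to (proj₂ mobility _ _ u≢v _) e))

      labels-⊆-x′ : {rs : List (Fin n × Fin n)} → All Distinct rs → labels lab rs ⊆ labels lab x′
      labels-⊆-x′ rs-distinct k∈ with ∈-map⁻ (label lab) k∈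
      ... | (a , b) , ab∈ , refl =
        subst (_∈ labels lab x′) relabel (label-∈ (Sum.map (∈-map⁺ _) (∈-map⁺ _) (EdgeAt⇒∈ edge)))
        where
        relabel : lab (F (f ⟨$⟩ˡ a)) (F (f ⟨$⟩ˡ b)) ≡ lab a b
        relabel = cong₂ lab (inverseʳ f) (inverseʳ f)
        a≢b : f ⟨$⟩ˡ a ≢ f ⟨$⟩ˡ b
        a≢b eq = All.lookup rs-distinct ab∈
                   (trans (sym (inverseʳ f)) (trans (cong F eq) (inverseʳ f)))
        edge : EdgeAt x (lab a b) (f ⟨$⟩ˡ a) (f ⟨$⟩ˡ b)
        edge = Equivalence.from (proj₂ mobility _ _ a≢b _) relabel

    representation-IsSchedule : {rs : List (Fin n × Fin n)} →
                                IsRepresentation lab rs → IsSchedule (map F π) rs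
    representation-IsSchedule {rs} (rs-distinct , rs-covers , rs-sorted) =
      IsSchedule-sameLabels x′-run same-labels x′-distinct rs-distinct′
      where
      rs-distinct′ : All Distinct rs
      rs-distinct′ = All.tabulate rs-distinct
      same-labels : labels lab x′ ≡ labels lab rs
      same-labels = strictlySorted-set⇒≡ x′-sorted (Linkedₚ.map⁺ rs-sorted)
        (mk⇔ (labels-⊆-covering x′-distinct rs-covers) (labels-⊆-x′ rs-distinct′))

mainTheorem8 : (n : ℕ) → n ≥ 2 → (lab : Labelling n) → IsMobilityClique lab →
    (rs : List (Fin n × Fin n)) → IsRepresentation lab rs →
    ∃ λ (π : List (Fin n)) →
      IsOrdering π × π ≢ reverse π ×
      IsSchedule π rs × IsSchedule (reverse π) rs ×
      (∀ (σ : List (Fin n)) → IsOrdering σ → IsSchedule σ rs →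
        σ ≡ π ⊎ σ ≡ reverse π)
mainTheorem8 (suc zero) (s≤s ()) _ _ _ _
mainTheorem8 (suc (suc m)) _ lab (clique , π , x , π-ord , x-run , mobility) rs rs-rep =
  π₀ , π₀-ord , IsOrdering⇒≢reverse π₀-ord , rs-run , IsSchedule-reverse rs-run ,
  λ σ σ-ord σ-run → schedule-origin-unique (proj₁ (proj₂ rs-rep)) π₀-ord rs-run σ-ord σ-run
  where
  π₀ : List (Fin (suc (suc m)))
  π₀ = map (proj₁ mobility ⟨$⟩ʳ_) π
  π₀-ord : IsOrdering π₀
  π₀-ord = map-IsOrdering (proj₁ mobility) π-ord
  rs-run : IsSchedule π₀ rs
  rs-run = representation-IsSchedule clique π-ord x-run mobility rs-rep
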